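{- Let $R$ be a ring, $n\ge 1$, and $B\in R^{2n\times 2n}$ a symmetric zero-diagonal matrix. Define $B^{(0)}=B$ and, for $i=1,\dots,n$, define the matrix $B^{(i)}\in R[U_i]^{(2n-2i)\times(2n-2i)}$ and the element $\beta^{(i)}\in R[U_i]$ by $$B^{(i)}_{j,k}=\begin{cases}B^{(i-1)}_{j+2,k+2}+1[\{i\}]\cdot\bigl(B^{(i-1)}_{1,j+2}\cdot B^{(i-1)}_{2,k+2}+B^{(i-1)}_{1,k+2}\cdot B^{(i-1)}_{2,j+2}\bigr) & j\neq k,\\ 0 & j=k,\end{cases}$$ $$\beta^{(i)}=1[\emptyset]+1[\{i\}]\cdot B^{(i-1)}_{1,2},$$ where all operations are in $R[U_i]$ (regarding $R[U_{i-1}]\subseteq R[U_i]$). Then for every $i$ with $1\le i\le n$ and every subset $X\subseteq\{1,\dots,i-1\}$, $$\bigl(\operatorname{haf}(B^{(i-1)})\bigr)_X=\bigl(\beta^{(i)}\cdot\operatorname{haf}(B^{(i)})\bigr)_{\{i\}\cup X}.$$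
   Context: For $m\ge 0$, the ring $R[U_m]$ consists of formal sums $r=\sum_{X\subseteq[m]} r_X[X]$ with coefficients $r_X\in R$ indexed by subsets $X$ of $[m]=\{1,\dots,m\}$ (i.e. vectors in $R^{2^{m}}$), with coordinatewise addition and multiplication $r\cdot q=\sum_{X\subseteq[m]}\bigl(\sum_{Y\subseteq X} r_Y q_{X\setminus Y}\bigr)[X]$. The element $1[\emptyset]$ is the multiplicative identity, $1[\{i\}]$ is the element with coefficient $1$ at $\{i\}$ and $0$ elsewhere, and elements of $R$ are identified with $a[\emptyset]$. $R[U_{i-1}]$ is regarded as a subring of $R[U_i]$ in the natural way. For a matrix $M$ of size $2p\times 2p$ over such a ring, $\operatorname{haf}(M)=\sum_{\sigma\in C_{2p}}\prod_{j=1}^{p} M_{\sigma(2j-1),\sigma(2j)}$, where $C_{2p}$ is the set of permutations $\sigma$ of $\{1,\dots,2p\}$ with $\sigma(2j-1)<\sigma(2j)$ for all $j$ and $\sigma(2j-1)<\sigma(2j+1)$ for all $j$; the hafnian of the $0\times 0$ matrix is defined to be $1[\emptyset]$. -}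

module Defs where

open import Level using (_⊔_)
open import Algebra.Bundles using (CommutativeRing)
open import Data.Bool using (Bool; true; false; _∧_; _∨_; not; if_then_else_)
open import Data.Nat using (ℕ; zero; suc; pred; _<ᵇ_)
import Data.Nat as N
open import Data.Fin using (Fin; zero; suc; toℕ; fromℕ; _≟_)
open import Data.Fin.Subset using (Subset; inside; outside; _∪_; _─_; ⁅_⁆; ⊥)
open import Data.Vec using (Vec; []; _∷_; _∷ʳ_; toList)
open import Data.List using (List; []; _∷_; map; concatMap; filterᵇ; foldr)
open import Relation.Nullary.Decidable using (⌊_⌋; yes; no)

-- square matrices of size s over A (row index, column index; index 0 = paper's index 1)
Mat : ∀ {a} → Set a → ℕ → Set a
Mat A s = Fin s → Fin s → A

-- all subsets of [m]  (a subset of [m] is a Vec Bool m; position j-1 <-> element j)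
allSubsets : (m : ℕ) → List (Subset m)
allSubsets zero    = [] ∷ []
allSubsets (suc m) = concatMap (λ Y → (outside ∷ Y) ∷ (inside ∷ Y) ∷ []) (allSubsets m)

_⊆ᵇ_ : ∀ {m} → Subset m → Subset m → Bool
[]      ⊆ᵇ []      = true
(y ∷ Y) ⊆ᵇ (x ∷ X) = (not y ∨ x) ∧ (Y ⊆ᵇ X)

isEmptyᵇ : ∀ {m} → Subset m → Bool
isEmptyᵇ []      = true
isEmptyᵇ (x ∷ X) = not x ∧ isEmptyᵇ X

allVecs : (s k : ℕ) → List (Vec (Fin s) k)
allVecs s zero    = [] ∷ []
allVecs s (suc k) = concatMap (λ v → map (λ a → a ∷ v) (allFinList s)) (allVecs s k)
  where
  allFinList : (s : ℕ) → List (Fin s)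
  allFinList zero    = []
  allFinList (suc s) = zero ∷ map suc (allFinList s)

distinctᵇ : ∀ {s} → List (Fin s) → Bool
distinctᵇ []       = true
distinctᵇ (a ∷ as) = not (foldr (λ b r → ⌊ a ≟ b ⌋ ∨ r) false as) ∧ distinctᵇ as

_<F_ : ∀ {s} → Fin s → Fin s → Bool
a <F b = toℕ a <ᵇ toℕ b

-- the conditions defining C_{2p} on the value sequence (σ(1),…,σ(2p)):
-- σ(2j-1) < σ(2j) and σ(2j-1) < σ(2j+1) for all j (odd length: no such σ)
canonᵇ : ∀ {s} → List (Fin s) → Bool
canonᵇ []                     = true
canonᵇ (a ∷ [])               = false
canonᵇ (a ∷ b ∷ [])           = a <F b
canonᵇ (a ∷ b ∷ (c ∷ rest))   = (a <F b) ∧ (a <F c) ∧ canonᵇ (c ∷ rest)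

C : (s : ℕ) → List (Vec (Fin s) s)
C s = filterᵇ (λ σ → distinctᵇ (toList σ) ∧ canonᵇ (toList σ)) (allVecs s s)

module WithRing {c ℓ} (R : CommutativeRing c ℓ) where
  open CommutativeRing R using (Carrier; _+_; _*_; 0#; 1#)

  RU : ℕ → Set c
  RU m = Subset m → Carrier

  _+U_ : ∀ {m} → RU m → RU m → RU m
  (r +U q) X = r X + q X

  _*U_ : ∀ {m} → RU m → RU m → RU m
  (r *U q) X = foldr _+_ 0#
    (map (λ Y → if Y ⊆ᵇ X then r Y * q (X ─ Y) else 0#) (allSubsets _))

  0U : ∀ {m} → RU m
  0U X = 0#

  const∅ : ∀ {m} → Carrier → RU m
  const∅ a X = if isEmptyᵇ X then a else 0#

  1U : ∀ {m} → RU m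
  1U = const∅ 1#

  -- 1[{i}] in R[U_i], i = suc m  (element i sits at position fromℕ m)
  single : (m : ℕ) → RU (suc m)
  single m X = if isEmptyᵇ (X ─ ⁅ fromℕ m ⁆) ∧ not (isEmptyᵇ X) then 1# else 0#

  embed : ∀ {m} → RU m → RU (suc m)
  embed {zero}  r (x ∷ [])     = if x then 0# else r []
  embed {suc m} r (x ∷ X)      = embed {m} (λ Y → r (x ∷ Y)) X

  prodPairs : ∀ {m s} → Mat (RU m) s → List (Fin s) → RU m
  prodPairs M []               = 1U
  prodPairs M (a ∷ [])         = 1U
  prodPairs M (a ∷ b ∷ rest)   = M a b *U prodPairs M rest

  haf : ∀ {m s} → Mat (RU m) s → RU m
  haf {m} {s} M = foldr _+U_ 0U (map (λ σ → prodPairs M (toList σ)) (C s))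

  -- one step B^(i-1) ↦ B^(i)   (i = suc m); only used with s ≥ 2
  step : ∀ {m s} → Mat (RU m) s → Mat (RU (suc m)) (pred (pred s))
  step {m} {zero}        M ()
  step {m} {suc zero}    M ()
  step {m} {suc (suc s)} M j k with j ≟ k
  ... | yes _ = 0U
  ... | no  _ =
    embed (M (suc (suc j)) (suc (suc k))) +U
      (single m *U (embed (M zero (suc (suc j)) *U M (suc zero) (suc (suc k)))
                  +U embed (M zero (suc (suc k)) *U M (suc zero) (suc (suc j)))))

  -- β^(i) = 1[∅] + 1[{i}] · B^(i-1)_{1,2}   (i = suc m); only used with s ≥ 2
  betaStep : ∀ {m s} → Mat (RU m) s → RU (suc m)
  betaStep {m} {suc (suc s)} M = 1U +U (single m *U embed (M zero (suc zero)))
  betaStep {m} {_}           M = 1U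

  size : ℕ → ℕ → ℕ
  size n zero    = 2 N.* n
  size n (suc i) = pred (pred (size n i))

  Bseq : (n : ℕ) → Mat Carrier (2 N.* n) → (i : ℕ) → Mat (RU i) (size n i)
  Bseq n B zero    j k = const∅ (B j k)
  Bseq n B (suc i)     = step (Bseq n B i)

  -- β^(i), i = suc m
  β : (n : ℕ) → Mat Carrier (2 N.* n) → (m : ℕ) → RU (suc m)
  β n B m = betaStep (Bseq n B m)

  insertLast : ∀ {m} → Subset m → Subset (suc m)
  insertLast {m} X = ⁅ fromℕ m ⁆ ∪ (X ∷ʳ outside)

-- Write ε = 1[{i}]. Splitting off the element i identifies R[U_i] with R[U_{i-1}][ε]/(ε²), and the
-- coefficient of r at {i} ∪ X is the coefficient at X of the ε-part of r. Let A′ be B^(i-1) without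
-- its first two rows and columns, and a, b its first two rows restricted to the remaining columns.
-- Then B^(i) = A′ + ε (a bᵀ + b aᵀ) off the diagonal and β^(i) = 1 + ε B^(i-1)_{1,2}, so, as ε² = 0,
-- the ε-part of β^(i) haf(B^(i)) is D + B^(i-1)_{1,2} haf(A′), where D is the first-order term of
-- haf(A′ + ε (a bᵀ + b aᵀ)). Expanding both hafnians recursively along their first index shows that D
-- is the sum over ordered pairs of distinct indices w, x of a_w b_x haf(A′ without w, x); the whole
-- expression is then the expansion of haf(B^(i-1)) along its first two rows. The recursive expansion
-- is identified with the defining sum over C_{2p} by showing that the sequences in C_{2p} are exactly
-- the pairings built by repeatedly matching the least unmatched index with another one.

module Submission where

open import Defs
open import Algebra.Bundles using (CommutativeRing)
import Algebra.Construct.Pointwise as Pointwise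
open import Data.Bool using (Bool; true; false; _∧_; not; if_then_else_; T)
import Data.Bool.Properties as Bool
open import Data.Empty using (⊥-elim)
open import Data.Fin using (Fin; zero; suc; fromℕ; _≟_; _<_)
open import Data.Fin.Properties using (<⇒≢)
open import Data.Fin.Subset using (Subset; inside; outside; _─_; ⁅_⁆)
open import Data.List using (List; []; _∷_; _++_; concatMap; filterᵇ; foldr)
import Data.List as List
open import Data.List.Properties using (map-cong)
open import Data.Nat using (ℕ; zero; suc; pred; _≤_)
import Data.Nat as N
open import Data.Nat.Properties using (<ᵇ⇒<; m≤n⇒∃[o]m+o≡n; +-suc; *-suc)
open import Data.Product using (_×_; _,_; proj₁; proj₂)
open import Data.Vec using (Vec; []; _∷_; _∷ʳ_; head; map; toList; allFin)
open import Data.Vec.Properties using (allFin-map; map-∘)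
open import Function.Bundles using (Equivalence)
open import Level using (Level; _⊔_)
open import Relation.Binary.PropositionalEquality as ≡ using (_≡_; _≢_)
open import Relation.Nullary.Decidable using (⌊_⌋; yes; no)

private variable
  ℓ₁ ℓ₂ : Level
  s n : ℕ

module CanonicalSequences where

  open import Data.Bool using (_∨_)
  open import Data.Bool.Properties using (T-∧)
  open import Data.Fin.Properties using (<-irrefl; <-asym; <-trans)
  open import Data.Nat using (z<s; s<s)
  open import Data.Nat.Properties using (<⇒<ᵇ)
  open import Data.Sum using (_⊎_; inj₁; inj₂)
  open import Data.Unit using (⊤; tt)
  open import Relation.Binary.PropositionalEquality using (refl; sym; subst)
  open import Relation.Nullary using (¬_)

  open Equivalence using (to; from)

  _∈ᵇ_ : Fin s → Vec (Fin s) n → Bool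
  a ∈ᵇ l = foldr (λ b r → ⌊ a ≟ b ⌋ ∨ r) false (toList l)

  ∈ᵇ-here : (a : Fin s) (l : Vec (Fin s) n) → T (a ∈ᵇ (a ∷ l))
  ∈ᵇ-here a l with a ≟ a
  ... | yes _   = tt
  ... | no a≢a = ⊥-elim (a≢a refl)

  ∈ᵇ-there : (a w : Fin s) (l : Vec (Fin s) n) → T (a ∈ᵇ l) → T (a ∈ᵇ (w ∷ l))
  ∈ᵇ-there a w l a∈l with a ≟ w
  ... | yes _ = tt
  ... | no _  = a∈l

  ∈ᵇ-∷⁻ : (a w : Fin s) (l : Vec (Fin s) n) → T (a ∈ᵇ (w ∷ l)) → a ≡ w ⊎ T (a ∈ᵇ l)
  ∈ᵇ-∷⁻ a w l a∈w∷l with a ≟ w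
  ... | yes a≡w = inj₁ a≡w
  ... | no _    = inj₂ a∈w∷l

  Distinct : Vec (Fin s) n → Set
  Distinct l = T (distinctᵇ (toList l))

  distinct-head : (v : Fin s) (l : Vec (Fin s) n) → Distinct (v ∷ l) → ¬ T (v ∈ᵇ l)
  distinct-head v l d v∈l with v ∈ᵇ l
  ... | true  = d
  ... | false = v∈l

  distinct-tail : (v : Fin s) (l : Vec (Fin s) n) → Distinct (v ∷ l) → Distinct l
  distinct-tail v l d with v ∈ᵇ l
  ... | true  = ⊥-elim d
  ... | false = d

  distinct-∷ : (v : Fin s) (l : Vec (Fin s) n) → ¬ T (v ∈ᵇ l) → Distinct l → Distinct (v ∷ l)
  distinct-∷ v l v∉l d with v ∈ᵇ l
  ... | true  = ⊥-elim (v∉l tt)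
  ... | false = d

  -- Deletes the first occurrence of b; if b does not occur, the last entry is dropped instead.
  remove : Vec (Fin s) (suc n) → Fin s → Vec (Fin s) n
  remove (w ∷ [])      b = []
  remove (w ∷ w′ ∷ ws) b with b ≟ w
  ... | yes _ = w′ ∷ ws
  ... | no _  = w ∷ remove (w′ ∷ ws) b

  ∈ᵇ-remove⁻ : (l : Vec (Fin s) (suc n)) (b x : Fin s) → T (x ∈ᵇ remove l b) → T (x ∈ᵇ l)
  ∈ᵇ-remove⁻ (w ∷ w′ ∷ ws) b x x∈ with b ≟ w
  ... | yes _ = ∈ᵇ-there x w (w′ ∷ ws) x∈
  ... | no _ with ∈ᵇ-∷⁻ x w (remove (w′ ∷ ws) b) x∈
  ...   | inj₁ refl = ∈ᵇ-here x (w′ ∷ ws)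
  ...   | inj₂ x∈′  = ∈ᵇ-there x w (w′ ∷ ws) (∈ᵇ-remove⁻ (w′ ∷ ws) b x x∈′)

  ∈ᵇ-remove⁺ : (l : Vec (Fin s) (suc n)) (b x : Fin s) →
               T (b ∈ᵇ l) → T (x ∈ᵇ l) → x ≢ b → T (x ∈ᵇ remove l b)
  ∈ᵇ-remove⁺ (w ∷ []) b x b∈ x∈ x≢b with ∈ᵇ-∷⁻ b w [] b∈ | ∈ᵇ-∷⁻ x w [] x∈
  ... | inj₁ refl | inj₁ refl = x≢b refl
  ∈ᵇ-remove⁺ (w ∷ w′ ∷ ws) b x b∈ x∈ x≢b
    with b ≟ w | ∈ᵇ-∷⁻ x w (w′ ∷ ws) x∈ | ∈ᵇ-∷⁻ b w (w′ ∷ ws) b∈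
  ... | yes refl | inj₁ refl | _        = ⊥-elim (x≢b refl)
  ... | yes refl | inj₂ x∈′  | _        = x∈′
  ... | no _     | inj₁ refl | _        = ∈ᵇ-here x (remove (w′ ∷ ws) b)
  ... | no b≢w   | inj₂ _    | inj₁ b≡w = ⊥-elim (b≢w b≡w)
  ... | no _     | inj₂ x∈′  | inj₂ b∈′ =
    ∈ᵇ-there x w (remove (w′ ∷ ws) b) (∈ᵇ-remove⁺ (w′ ∷ ws) b x b∈′ x∈′ x≢b)

  remove-∉ : (l : Vec (Fin s) (suc n)) (b : Fin s) → Distinct l → ¬ T (b ∈ᵇ remove l b)
  remove-∉ (w ∷ w′ ∷ ws) b d b∈ with b ≟ w
  ... | yes refl = distinct-head w (w′ ∷ ws) d b∈
  ... | no b≢w with ∈ᵇ-∷⁻ b w (remove (w′ ∷ ws) b) b∈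
  ...   | inj₁ b≡w = b≢w b≡w
  ...   | inj₂ b∈′ = remove-∉ (w′ ∷ ws) b (distinct-tail w (w′ ∷ ws) d) b∈′

  remove-distinct : (l : Vec (Fin s) (suc n)) (b : Fin s) → Distinct l → Distinct (remove l b)
  remove-distinct (w ∷ [])      b d = tt
  remove-distinct (w ∷ w′ ∷ ws) b d with b ≟ w
  ... | yes _ = distinct-tail w (w′ ∷ ws) d
  ... | no _  = distinct-∷ w (remove (w′ ∷ ws) b)
                  (λ w∈ → distinct-head w (w′ ∷ ws) d (∈ᵇ-remove⁻ (w′ ∷ ws) b w w∈))
                  (remove-distinct (w′ ∷ ws) b (distinct-tail w (w′ ∷ ws) d))

  Sorted : Vec (Fin s) n → Set
  Sorted []      = ⊤
  Sorted (v ∷ l) = (∀ x → T (x ∈ᵇ l) → v < x) × Sorted l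

  sorted⇒distinct : (l : Vec (Fin s) n) → Sorted l → Distinct l
  sorted⇒distinct []      _         = tt
  sorted⇒distinct (v ∷ l) (v< , st) =
    distinct-∷ v l (λ v∈ → <-irrefl refl (v< v v∈)) (sorted⇒distinct l st)

  remove-sorted : (l : Vec (Fin s) (suc n)) (b : Fin s) → Sorted l → Sorted (remove l b)
  remove-sorted (w ∷ [])      b _ = tt
  remove-sorted (w ∷ w′ ∷ ws) b (w< , st) with b ≟ w
  ... | yes _ = st
  ... | no _  = (λ x x∈ → w< x (∈ᵇ-remove⁻ (w′ ∷ ws) b x x∈)) , remove-sorted (w′ ∷ ws) b st

  canon-∷∷∷⁻ : (a b c : Fin s) (r : List (Fin s)) →
               T (canonᵇ (a ∷ b ∷ c ∷ r)) → a < b × a < c × T (canonᵇ (c ∷ r))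
  canon-∷∷∷⁻ a b c r p with to (T-∧ {a <F b}) p
  ... | a<b , q with to (T-∧ {a <F c}) q
  ...   | a<c , cr = <ᵇ⇒< _ _ a<b , <ᵇ⇒< _ _ a<c , cr

  canon-∷∷∷⁺ : (a b c : Fin s) (r : List (Fin s)) →
               a < b → a < c → T (canonᵇ (c ∷ r)) → T (canonᵇ (a ∷ b ∷ c ∷ r))
  canon-∷∷∷⁺ a b c r a<b a<c cr =
    from (T-∧ {a <F b}) (<⇒<ᵇ a<b , from (T-∧ {a <F c}) (<⇒<ᵇ a<c , cr))

  canon-drop-pair : (a b : Fin s) (r : List (Fin s)) → T (canonᵇ (a ∷ b ∷ r)) → T (canonᵇ r)
  canon-drop-pair a b []      _ = tt
  canon-drop-pair a b (c ∷ r) p = proj₂ (proj₂ (canon-∷∷∷⁻ a b c r p))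

  canon-head-least : (a : Fin s) (ρ : Vec (Fin s) n) →
                     T (canonᵇ (a ∷ toList ρ)) → ∀ x → T (x ∈ᵇ ρ) → a < x
  canon-head-least a (b ∷ []) p x x∈ with ∈ᵇ-∷⁻ x b [] x∈
  ... | inj₁ refl = <ᵇ⇒< _ _ p
  canon-head-least a (b ∷ c ∷ r) p x x∈ with canon-∷∷∷⁻ a b c (toList r) p
  ... | a<b , a<c , cr with ∈ᵇ-∷⁻ x b (c ∷ r) x∈
  ...   | inj₁ refl = a<b
  ...   | inj₂ x∈′ with ∈ᵇ-∷⁻ x c r x∈′
  ...     | inj₁ refl = a<c
  ...     | inj₂ x∈″  = <-trans a<c (canon-head-least c r cr x x∈″)

  _⊆ᵛ_ : Vec (Fin s) n → Vec (Fin s) n → Set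
  σ ⊆ᵛ vs = ∀ x → T (x ∈ᵇ σ) → T (x ∈ᵇ vs)

  -- Pigeonhole.
  distinct-⊆ᵛ⇒⊇ᵛ : (σ vs : Vec (Fin s) n) → Distinct σ → σ ⊆ᵛ vs → vs ⊆ᵛ σ
  distinct-⊆ᵛ⇒⊇ᵛ []      []  _ _     _ ()
  distinct-⊆ᵛ⇒⊇ᵛ (a ∷ σ) vs d σ⊆vs x x∈vs with x ≟ a
  ... | yes refl = tt
  ... | no x≢a   =
    distinct-⊆ᵛ⇒⊇ᵛ σ (remove vs a) (distinct-tail a σ d) σ⊆vs∖a x (∈ᵇ-remove⁺ vs a x a∈vs x∈vs x≢a)
    where
    a∈vs : T (a ∈ᵇ vs)
    a∈vs = σ⊆vs a (∈ᵇ-here a σ)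
    σ⊆vs∖a : σ ⊆ᵛ remove vs a
    σ⊆vs∖a y y∈σ = ∈ᵇ-remove⁺ vs a y a∈vs (σ⊆vs y (∈ᵇ-there y a σ y∈σ))
                     (λ { refl → distinct-head a σ d y∈σ })

  -- σ lists the pairs of a perfect matching of the entries of vs, each pair led by the
  -- first entry of vs not matched by an earlier pair.
  pairingᵇ : Vec (Fin s) n → Vec (Fin s) n → Bool
  pairingᵇ []           []          = true
  pairingᵇ (v ∷ [])     (a ∷ [])    = false
  pairingᵇ (v ∷ w ∷ ws) (a ∷ b ∷ ρ) = ⌊ a ≟ v ⌋ ∧ (b ∈ᵇ (w ∷ ws) ∧ pairingᵇ (remove (w ∷ ws) b) ρ)

  pairing-∷∷⁻ : (v w a b : Fin s) (ws ρ : Vec (Fin s) n) → T (pairingᵇ (v ∷ w ∷ ws) (a ∷ b ∷ ρ)) →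
                a ≡ v × T (b ∈ᵇ (w ∷ ws)) × T (pairingᵇ (remove (w ∷ ws) b) ρ)
  pairing-∷∷⁻ v w a b ws ρ p with a ≟ v
  ... | yes a≡v = a≡v , to (T-∧ {b ∈ᵇ (w ∷ ws)}) p

  pairing⇒⊆ᵛ : (vs σ : Vec (Fin s) n) → T (pairingᵇ vs σ) → σ ⊆ᵛ vs
  pairing⇒⊆ᵛ []           []          _  _ ()
  pairing⇒⊆ᵛ (v ∷ [])     (a ∷ [])    () _ _
  pairing⇒⊆ᵛ (v ∷ w ∷ ws) (a ∷ b ∷ ρ) p  x x∈
    with pairing-∷∷⁻ v w a b ws ρ p
  ... | refl , b∈ , ρ-pairing with ∈ᵇ-∷⁻ x a (b ∷ ρ) x∈
  ...   | inj₁ refl = ∈ᵇ-here x (w ∷ ws)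
  ...   | inj₂ x∈′ with ∈ᵇ-∷⁻ x b ρ x∈′
  ...     | inj₁ refl = ∈ᵇ-there x a (w ∷ ws) b∈
  ...     | inj₂ x∈ρ  = ∈ᵇ-there x a (w ∷ ws)
                          (∈ᵇ-remove⁻ (w ∷ ws) b x (pairing⇒⊆ᵛ (remove (w ∷ ws) b) ρ ρ-pairing x x∈ρ))

  canon-∷∷ : (a b : Fin s) (ρ : Vec (Fin s) n) →
             a < b → (∀ x → T (x ∈ᵇ ρ) → a < x) → T (canonᵇ (toList ρ)) → T (canonᵇ (a ∷ b ∷ toList ρ))
  canon-∷∷ a b []      a<b _  _  = <⇒<ᵇ a<b
  canon-∷∷ a b (c ∷ ρ) a<b a<ρ cρ = canon-∷∷∷⁺ a b c (toList ρ) a<b (a<ρ c (∈ᵇ-here c ρ)) cρ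

  pairing⇒canonical : (vs σ : Vec (Fin s) n) → Sorted vs → T (pairingᵇ vs σ) →
                      Distinct σ × T (canonᵇ (toList σ))
  pairing⇒canonical []           []          _         _ = tt , tt
  pairing⇒canonical (v ∷ [])     (a ∷ [])    _         ()
  pairing⇒canonical (v ∷ l@(w ∷ ws)) (a ∷ b ∷ ρ) (v< , st) p
    with pairing-∷∷⁻ v w a b ws ρ p
  ... | refl , b∈ , ρ-pairing =
    distinct-∷ a (b ∷ ρ) a∉ (distinct-∷ b ρ b∉ (proj₁ ρ-canonical)) ,
    canon-∷∷ a b ρ (v< b b∈) (λ x x∈ρ → v< x (∈ᵇ-remove⁻ l b x (ρ⊆ x x∈ρ))) (proj₂ ρ-canonical)
    where
    ρ-canonical : Distinct ρ × T (canonᵇ (toList ρ))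
    ρ-canonical = pairing⇒canonical (remove l b) ρ (remove-sorted l b st) ρ-pairing
    ρ⊆ : ρ ⊆ᵛ remove l b
    ρ⊆ = pairing⇒⊆ᵛ (remove l b) ρ ρ-pairing
    a∉ : ¬ T (a ∈ᵇ (b ∷ ρ))
    a∉ a∈ with ∈ᵇ-∷⁻ a b ρ a∈
    ... | inj₁ refl = <-irrefl refl (v< a b∈)
    ... | inj₂ a∈ρ  = <-irrefl refl (v< a (∈ᵇ-remove⁻ l b a (ρ⊆ a a∈ρ)))
    b∉ : ¬ T (b ∈ᵇ ρ)
    b∉ b∈ρ = remove-∉ l b (sorted⇒distinct l st) (ρ⊆ b b∈ρ)

  canonical⇒pairing : (vs σ : Vec (Fin s) n) → Sorted vs → Distinct σ → T (canonᵇ (toList σ)) →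
                      σ ⊆ᵛ vs → T (pairingᵇ vs σ)
  canonical⇒pairing []           []          _         _ _  _  = tt
  canonical⇒pairing (v ∷ [])     (a ∷ [])    _         _ () _
  canonical⇒pairing (v ∷ l@(w ∷ ws)) (a ∷ b ∷ ρ) (v< , st) d cn σ⊆ with a ≟ v
  ... | no a≢v   = ⊥-elim (<-asym v<a a<v)
    where
    a<v : a < v
    a<v with ∈ᵇ-∷⁻ v a (b ∷ ρ) (distinct-⊆ᵛ⇒⊇ᵛ (a ∷ b ∷ ρ) (v ∷ w ∷ ws) d σ⊆ v (∈ᵇ-here v (w ∷ ws)))
    ... | inj₁ v≡a = ⊥-elim (a≢v (sym v≡a))
    ... | inj₂ v∈  = canon-head-least a (b ∷ ρ) cn v v∈
    v<a : v < a
    v<a with ∈ᵇ-∷⁻ a v (w ∷ ws) (σ⊆ a (∈ᵇ-here a (b ∷ ρ)))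
    ... | inj₁ a≡v = ⊥-elim (a≢v a≡v)
    ... | inj₂ a∈  = v< a a∈
  ... | yes refl = from (T-∧ {b ∈ᵇ l}) (b∈ ,
    canonical⇒pairing (remove l b) ρ (remove-sorted l b st) dρ (canon-drop-pair a b (toList ρ) cn) ρ⊆)
    where
    dbρ : Distinct (b ∷ ρ)
    dbρ = distinct-tail a (b ∷ ρ) d
    dρ : Distinct ρ
    dρ = distinct-tail b ρ dbρ
    bρ⊆ : ∀ x → T (x ∈ᵇ (b ∷ ρ)) → T (x ∈ᵇ l)
    bρ⊆ x x∈ with ∈ᵇ-∷⁻ x a l (σ⊆ x (∈ᵇ-there x a (b ∷ ρ) x∈))
    ... | inj₁ refl = ⊥-elim (distinct-head a (b ∷ ρ) d x∈)
    ... | inj₂ x∈l  = x∈l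
    b∈ : T (b ∈ᵇ l)
    b∈ = bρ⊆ b (∈ᵇ-here b ρ)
    ρ⊆ : ρ ⊆ᵛ remove l b
    ρ⊆ x x∈ = ∈ᵇ-remove⁺ l b x b∈ (bρ⊆ x (∈ᵇ-there x b ρ x∈)) (λ { refl → distinct-head b ρ dbρ x∈ })

  ∈ᵇ-map-suc : (y : Fin s) (l : Vec (Fin s) n) → suc y ∈ᵇ map suc l ≡ y ∈ᵇ l
  ∈ᵇ-map-suc y []      = refl
  ∈ᵇ-map-suc y (w ∷ l) with y ≟ w
  ... | yes _ = refl
  ... | no _  = ∈ᵇ-map-suc y l

  zero-∉ᵇ-map-suc : (l : Vec (Fin s) n) → zero ∈ᵇ map suc l ≡ false
  zero-∉ᵇ-map-suc []      = refl
  zero-∉ᵇ-map-suc (w ∷ l) = zero-∉ᵇ-map-suc l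

  ∈ᵇ-allFin : (x : Fin s) → T (x ∈ᵇ allFin s)
  ∈ᵇ-allFin {suc s} zero    = tt
  ∈ᵇ-allFin {suc s} (suc y) = subst (λ l → T (suc y ∈ᵇ l)) (sym (allFin-map s))
    (subst T (sym (∈ᵇ-map-suc y (allFin s))) (∈ᵇ-allFin y))

  map-suc-sorted : (l : Vec (Fin s) n) → Sorted l → Sorted (map suc l)
  map-suc-sorted []      _         = tt
  map-suc-sorted (v ∷ l) (v< , st) = suc-v< , map-suc-sorted l st
    where
    suc-v< : ∀ x → T (x ∈ᵇ map suc l) → suc v < x
    suc-v< zero    x∈ rewrite zero-∉ᵇ-map-suc l = ⊥-elim x∈
    suc-v< (suc y) x∈ rewrite ∈ᵇ-map-suc y l = s<s (v< y x∈)

  allFin-sorted : (s : ℕ) → Sorted (allFin s)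
  allFin-sorted zero = tt
  allFin-sorted (suc s) =
    subst Sorted (sym (allFin-map s)) (zero-least , map-suc-sorted (allFin s) (allFin-sorted s))
    where
    zero-least : (x : Fin (suc s)) → T (x ∈ᵇ map suc (allFin s)) → zero {n = s} < x
    zero-least zero    x∈ rewrite zero-∉ᵇ-map-suc (allFin s) = ⊥-elim x∈
    zero-least (suc y) _  = z<s

  T-injective : {x y : Bool} → (T x → T y) → (T y → T x) → x ≡ y
  T-injective {false} {false} _ _ = refl
  T-injective {false} {true}  _ g = ⊥-elim (g tt)
  T-injective {true}  {false} f _ = ⊥-elim (f tt)
  T-injective {true}  {true}  _ _ = refl

  C-predicate≡pairing : (σ : Vec (Fin s) s) →
                        distinctᵇ (toList σ) ∧ canonᵇ (toList σ) ≡ pairingᵇ (allFin s) σ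
  C-predicate≡pairing {s} σ = T-injective
    (λ p → let d , cn = to (T-∧ {distinctᵇ (toList σ)}) p in
           canonical⇒pairing (allFin s) σ (allFin-sorted s) d cn (λ x _ → ∈ᵇ-allFin x))
    (λ p → from (T-∧ {distinctᵇ (toList σ)}) (pairing⇒canonical (allFin s) σ (allFin-sorted s) p))

open CanonicalSequences

module RingSums {c ℓ} (S : CommutativeRing c ℓ) where

  open CommutativeRing S hiding (zero)
  open import Relation.Binary.Reasoning.Setoid setoid
  open import Algebra.Properties.CommutativeSemigroup +-commutativeSemigroup using (interchange)

  private variable
    X Y : Set ℓ₁

  keepIf : Bool → Carrier → Carrier
  keepIf p x = if p then x else 0#

  keepIf-cong : (p : Bool) {x y : Carrier} → (T p → x ≈ y) → keepIf p x ≈ keepIf p y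
  keepIf-cong true  x≈y = x≈y _
  keepIf-cong false _   = refl

  keepIf-* : (p : Bool) (a x : Carrier) → keepIf p (a * x) ≈ a * keepIf p x
  keepIf-* true  a x = refl
  keepIf-* false a x = sym (zeroʳ a)

  keepIf-∧ : (p q : Bool) (x : Carrier) → keepIf (p ∧ q) x ≡ keepIf p (keepIf q x)
  keepIf-∧ true  q x = ≡.refl
  keepIf-∧ false q x = ≡.refl

  sumList : List X → (X → Carrier) → Carrier
  sumList xs f = foldr _+_ 0# (List.map f xs)

  sumList-cong : (xs : List X) {f g : X → Carrier} → (∀ x → f x ≈ g x) → sumList xs f ≈ sumList xs g
  sumList-cong []       _ = refl
  sumList-cong (x ∷ xs) f≈g = +-cong (f≈g x) (sumList-cong xs f≈g)

  sumList-+ : (xs : List X) (f g : X → Carrier) →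
              sumList xs (λ x → f x + g x) ≈ sumList xs f + sumList xs g
  sumList-+ []       f g = sym (+-identityˡ 0#)
  sumList-+ (x ∷ xs) f g = trans (+-congˡ (sumList-+ xs f g)) (interchange _ _ _ _)

  sumList-0 : (xs : List X) → sumList xs (λ _ → 0#) ≈ 0#
  sumList-0 []       = refl
  sumList-0 (x ∷ xs) = trans (+-identityˡ _) (sumList-0 xs)

  *-distribˡ-sumList : (xs : List X) (a : Carrier) (f : X → Carrier) →
                       a * sumList xs f ≈ sumList xs (λ x → a * f x)
  *-distribˡ-sumList []       a f = zeroʳ a
  *-distribˡ-sumList (x ∷ xs) a f = trans (distribˡ a _ _) (+-congˡ (*-distribˡ-sumList xs a f))

  sumList-swap : (xs : List X) (ys : List Y) (f : X → Y → Carrier) →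
                 sumList xs (λ x → sumList ys (f x)) ≈ sumList ys (λ y → sumList xs (λ x → f x y))
  sumList-swap []       ys f = sym (sumList-0 ys)
  sumList-swap (x ∷ xs) ys f = trans (+-congˡ (sumList-swap xs ys f)) (sym (sumList-+ ys _ _))

  sumList-++ : (xs ys : List X) (f : X → Carrier) → sumList (xs ++ ys) f ≈ sumList xs f + sumList ys f
  sumList-++ []       ys f = sym (+-identityˡ _)
  sumList-++ (x ∷ xs) ys f = trans (+-congˡ (sumList-++ xs ys f)) (sym (+-assoc _ _ _))

  sumList-concatMap : (g : X → List Y) (xs : List X) (f : Y → Carrier) →
                      sumList (concatMap g xs) f ≈ sumList xs (λ x → sumList (g x) f)
  sumList-concatMap g []       f = refl
  sumList-concatMap g (x ∷ xs) f =
    trans (sumList-++ (g x) (concatMap g xs) f) (+-congˡ (sumList-concatMap g xs f))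

  sumList-map : (g : X → Y) (xs : List X) (f : Y → Carrier) →
                sumList (List.map g xs) f ≈ sumList xs (λ x → f (g x))
  sumList-map g []       f = refl
  sumList-map g (x ∷ xs) f = +-congˡ (sumList-map g xs f)

  sumList-filterᵇ : (p : X → Bool) (xs : List X) (f : X → Carrier) →
                    sumList (filterᵇ p xs) f ≈ sumList xs (λ x → keepIf (p x) (f x))
  sumList-filterᵇ p []       f = refl
  sumList-filterᵇ p (x ∷ xs) f with p x
  ... | true  = +-congˡ (sumList-filterᵇ p xs f)
  ... | false = trans (sumList-filterᵇ p xs f) (sym (+-identityˡ _))

  -- sumPicks l g sums g w r over the entries w of l, r being l with that entry deleted.
  sumPicks : {A : Set ℓ₁} → Vec A n → (A → Vec A (pred n) → Carrier) → Carrier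
  sumPicks []           g = 0#
  sumPicks (x ∷ [])     g = g x []
  sumPicks (x ∷ y ∷ ys) g = g x (y ∷ ys) + sumPicks (y ∷ ys) (λ z zs → g z (x ∷ zs))

  module _ {A : Set ℓ₁} where

    sumPicks-∷ : (x : A) (r : Vec A (suc n)) (g : A → Vec A (suc n) → Carrier) →
                 sumPicks (x ∷ r) g ≈ g x r + sumPicks r (λ z zs → g z (x ∷ zs))
    sumPicks-∷ x (y ∷ ys) g = refl

    sumPicks-cong : (l : Vec A n) {g h : A → Vec A (pred n) → Carrier} →
                    (∀ w r → g w r ≈ h w r) → sumPicks l g ≈ sumPicks l h
    sumPicks-cong []           _   = refl
    sumPicks-cong (x ∷ [])     g≈h = g≈h x []
    sumPicks-cong (x ∷ y ∷ ys) g≈h = +-cong (g≈h x _) (sumPicks-cong (y ∷ ys) (λ z zs → g≈h z (x ∷ zs)))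

    sumPicks-+ : (l : Vec A n) (g h : A → Vec A (pred n) → Carrier) →
                 sumPicks l (λ w r → g w r + h w r) ≈ sumPicks l g + sumPicks l h
    sumPicks-+ []           g h = sym (+-identityˡ 0#)
    sumPicks-+ (x ∷ [])     g h = refl
    sumPicks-+ (x ∷ y ∷ ys) g h = trans (+-congˡ (sumPicks-+ (y ∷ ys) _ _)) (interchange _ _ _ _)

    *-distribˡ-sumPicks : (l : Vec A n) (a : Carrier) (g : A → Vec A (pred n) → Carrier) →
                          a * sumPicks l g ≈ sumPicks l (λ w r → a * g w r)
    *-distribˡ-sumPicks []           a g = zeroʳ a
    *-distribˡ-sumPicks (x ∷ [])     a g = refl
    *-distribˡ-sumPicks (x ∷ y ∷ ys) a g = trans (distribˡ a _ _) (+-congˡ (*-distribˡ-sumPicks (y ∷ ys) a _))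

    -- Picking w and then x from the rest ranges over the same ordered pairs as picking x, then w.
    sumPicks-swap : (l : Vec A n) (g : A → A → Vec A (pred (pred n)) → Carrier) →
                    sumPicks l (λ w r → sumPicks r (g w)) ≈ sumPicks l (λ x r → sumPicks r (λ w r′ → g w x r′))
    sumPicks-swap []               g = refl
    sumPicks-swap (x ∷ [])         g = refl
    sumPicks-swap (x ∷ y ∷ [])     g = +-comm _ _
    sumPicks-swap (x ∷ l@(y ∷ z ∷ zs)) g = begin
      P + sumPicks l (λ w r → sumPicks (x ∷ r) (g w))
        ≈⟨ +-congˡ (trans (sumPicks-cong l (λ w r → sumPicks-∷ x r (g w)))
                          (sumPicks-+ l (λ w r → g w x r) (λ w r → sumPicks r (λ x′ r′ → g w x′ (x ∷ r′))))) ⟩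
      P + (Q + sumPicks l (λ w r → sumPicks r (λ x′ r′ → g w x′ (x ∷ r′))))
        ≈⟨ +-congˡ (+-congˡ (sumPicks-swap l (λ w x′ r′ → g w x′ (x ∷ r′)))) ⟩
      P + (Q + Rest)  ≈⟨ sym (+-assoc _ _ _) ⟩
      (P + Q) + Rest  ≈⟨ +-congʳ (+-comm P Q) ⟩
      (Q + P) + Rest  ≈⟨ +-assoc _ _ _ ⟩
      Q + (P + Rest)
        ≈⟨ +-congˡ (sym (trans (sumPicks-cong l (λ x′ r → sumPicks-∷ x r (λ w r′ → g w x′ r′)))
                               (sumPicks-+ l (g x) (λ x′ r → sumPicks r (λ w r′ → g w x′ (x ∷ r′)))))) ⟩
      Q + sumPicks l (λ x′ r → sumPicks (x ∷ r) (λ w r′ → g w x′ r′)) ∎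
      where
      P Q Rest : Carrier
      P    = sumPicks l (g x)
      Q    = sumPicks l (λ w r → g w x r)
      Rest = sumPicks l (λ x′ r → sumPicks r (λ w r′ → g w x′ (x ∷ r′)))

  sumPicks-map : {A : Set ℓ₁} {B : Set ℓ₂} (f : A → B) (l : Vec A n) (g : B → Vec B (pred n) → Carrier) →
                 sumPicks (map f l) g ≈ sumPicks l (λ w r → g (f w) (map f r))
  sumPicks-map f []           g = refl
  sumPicks-map f (x ∷ [])     g = refl
  sumPicks-map f (x ∷ y ∷ ys) g = +-congˡ (sumPicks-map f (y ∷ ys) _)

module RecursiveHafnian {c ℓ} (S : CommutativeRing c ℓ) where

  open CommutativeRing S hiding (zero)
  open RingSums S
  open import Relation.Binary.Reasoning.Setoid setoid

  -- The hafnian of the submatrix of M on the indices l, expanded along the first index.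
  hafOn : {I : Set ℓ₁} → (I → I → Carrier) → Vec I n → Carrier
  hafOn M []           = 1#
  hafOn M (v ∷ [])     = 0#
  hafOn {n = suc (suc n)} M (v ∷ w ∷ ws) = sumPicks (w ∷ ws) (λ x r → M v x * hafOn {n = n} M r)

  hafOn-∷ : {I : Set ℓ₁} (M : I → I → Carrier) (v : I) (ws : Vec I n) →
            hafOn M (v ∷ ws) ≈ sumPicks ws (λ w r → M v w * hafOn M r)
  hafOn-∷ M v []       = refl
  hafOn-∷ M v (w ∷ ws) = refl

  hafOn-map : {I : Set ℓ₁} {J : Set ℓ₂} (M : J → J → Carrier) (f : I → J) (l : Vec I n) →
              hafOn M (map f l) ≈ hafOn (λ x y → M (f x) (f y)) l
  hafOn-map M f []           = refl
  hafOn-map M f (v ∷ [])     = refl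
  hafOn-map {n = suc (suc n)} M f (v ∷ w ∷ ws) =
    trans (sumPicks-map f (w ∷ ws) _) (sumPicks-cong (w ∷ ws) (λ x r → *-congˡ (hafOn-map {n = n} M f r)))

  module Rank2Perturbation {I : Set ℓ₁} (A : I → I → Carrier) (a b : I → Carrier) where

    crossSum : Vec I n → Carrier
    crossSum l = sumPicks l (λ w r → sumPicks r (λ x r′ → a w * b x * hafOn A r′))

    -- The ε-coefficient of the hafnian of A + ε (a bᵀ + b aᵀ) when ε² = 0.
    hafDeriv : Vec I n → Carrier
    hafDeriv []           = 0#
    hafDeriv (v ∷ [])     = 0#
    hafDeriv {n = suc (suc n)} (v ∷ w ∷ ws) =
      sumPicks (w ∷ ws) (λ x r → (a v * b x + a x * b v) * hafOn A r + A v x * hafDeriv {n = n} r)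

    crossSum-∷ : (v : I) (ws : Vec I (suc (suc n))) →
                 crossSum (v ∷ ws) ≈ sumPicks ws (λ w r → (a v * b w + a w * b v) * hafOn A r)
                                     + sumPicks ws (λ w r → sumPicks r (λ x q → a w * b x * hafOn A (v ∷ q)))
    crossSum-∷ v ws = begin
      crossSum (v ∷ ws)
        ≈⟨ sumPicks-∷ v ws _ ⟩
      sumPicks ws (f v) + sumPicks ws (λ w r → sumPicks (v ∷ r) (f w))
        ≈⟨ +-congˡ (trans (sumPicks-cong ws (λ w r → sumPicks-∷ v r (f w)))
                          (sumPicks-+ ws (λ w r → f w v r) (λ w r → sumPicks r (λ x q → f w x (v ∷ q))))) ⟩
      sumPicks ws (f v) + (sumPicks ws (λ w r → f w v r) + Rest)
        ≈⟨ sym (+-assoc _ _ _) ⟩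
      (sumPicks ws (f v) + sumPicks ws (λ w r → f w v r)) + Rest
        ≈⟨ +-congʳ (sym (trans (sumPicks-cong ws (λ w r → distribʳ _ _ _)) (sumPicks-+ ws _ _))) ⟩
      sumPicks ws (λ w r → (a v * b w + a w * b v) * hafOn A r) + Rest ∎
      where
      f : I → I → Vec I (suc n) → Carrier
      f w x r = a w * b x * hafOn A r
      Rest : Carrier
      Rest = sumPicks ws (λ w r → sumPicks r (λ x q → f w x (v ∷ q)))

    -- Expanding haf (v ∷ q) along v and moving that pick to the front.
    crossSum-unfold : (v : I) (ws : Vec I n) →
                      sumPicks ws (λ w r → sumPicks r (λ x q → a w * b x * hafOn A (v ∷ q)))
                      ≈ sumPicks ws (λ y r → A v y * crossSum r)
    crossSum-unfold v ws = begin
      sumPicks ws (λ w r → sumPicks r (λ x q → a w * b x * hafOn A (v ∷ q)))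
        ≈⟨ sumPicks-cong ws (λ w r → sumPicks-cong r (λ x q →
             trans (*-congˡ (hafOn-∷ A v q)) (*-distribˡ-sumPicks q _ _))) ⟩
      sumPicks ws (λ w r → sumPicks r (λ x q → sumPicks q (λ y q′ → F w x y q′)))
        ≈⟨ sumPicks-cong ws (λ w r → sumPicks-swap r (λ x y q′ → F w x y q′)) ⟩
      sumPicks ws (λ w r → sumPicks r (λ y q → sumPicks q (λ x q′ → F w x y q′)))
        ≈⟨ sumPicks-swap ws (λ w y q → sumPicks q (λ x q′ → F w x y q′)) ⟩
      sumPicks ws (λ y r → sumPicks r (λ w q → sumPicks q (λ x q′ → F w x y q′)))
        ≈⟨ sumPicks-cong ws (λ y r → sumPicks-cong r (λ w q → sumPicks-cong q (λ x q′ → F-comm w x y q′))) ⟩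
      sumPicks ws (λ y r → sumPicks r (λ w q → sumPicks q (λ x q′ → A v y * (a w * b x * hafOn A q′))))
        ≈⟨ sumPicks-cong ws (λ y r → sym (trans (*-distribˡ-sumPicks r _ _)
                                               (sumPicks-cong r (λ w q → *-distribˡ-sumPicks q _ _)))) ⟩
      sumPicks ws (λ y r → A v y * crossSum r) ∎
      where
      F : I → I → I → Vec I _ → Carrier
      F w x y q′ = a w * b x * (A v y * hafOn A q′)
      F-comm : ∀ w x y q′ → F w x y q′ ≈ A v y * (a w * b x * hafOn A q′)
      F-comm w x y q′ = trans (sym (*-assoc _ _ _)) (trans (*-congʳ (*-comm _ _)) (*-assoc _ _ _))

    crossSum≈hafDeriv : (l : Vec I n) → crossSum l ≈ hafDeriv l
    crossSum≈hafDeriv []           = refl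
    crossSum≈hafDeriv (v ∷ [])     = refl
    crossSum≈hafDeriv (v ∷ w ∷ []) = begin
      a v * b w * 1# + a w * b v * 1#      ≈⟨ sym (distribʳ 1# _ _) ⟩
      (a v * b w + a w * b v) * 1#         ≈⟨ sym (+-identityʳ _) ⟩
      (a v * b w + a w * b v) * 1# + 0#    ≈⟨ +-congˡ (sym (zeroʳ (A v w))) ⟩
      (a v * b w + a w * b v) * 1# + A v w * 0# ∎
    crossSum≈hafDeriv {n = suc (suc (suc n))} (v ∷ ws@(_ ∷ _ ∷ _)) = begin
      crossSum (v ∷ ws)
        ≈⟨ crossSum-∷ v ws ⟩
      sumPicks ws (λ w r → (a v * b w + a w * b v) * hafOn A r)
        + sumPicks ws (λ w r → sumPicks r (λ x q → a w * b x * hafOn A (v ∷ q)))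
        ≈⟨ +-congˡ (trans (crossSum-unfold v ws)
                          (sumPicks-cong ws (λ y r → *-congˡ {A v y} (crossSum≈hafDeriv {n = suc n} r)))) ⟩
      sumPicks ws (λ w r → (a v * b w + a w * b v) * hafOn A r) + sumPicks ws (λ w r → A v w * hafDeriv r)
        ≈⟨ sym (sumPicks-+ ws (λ w r → (a v * b w + a w * b v) * hafOn A r) (λ w r → A v w * hafDeriv r)) ⟩
      hafDeriv (v ∷ ws) ∎

  module _ {I : Set ℓ₁} {J : Set ℓ₂} (A : J → J → Carrier) (z₀ z₁ : J) (f : I → J) where

    private
      A′ : I → I → Carrier
      A′ x y = A (f x) (f y)
      a b : I → Carrier
      a x = A z₀ (f x)
      b x = A z₁ (f x)
    open Rank2Perturbation A′ a b

    hafOn-expand₂ : (l : Vec I n) → hafOn A (z₀ ∷ z₁ ∷ map f l) ≈ A z₀ z₁ * hafOn A′ l + crossSum l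
    hafOn-expand₂ []      = sym (+-identityʳ _)
    hafOn-expand₂ l@(_ ∷ _) = begin
      hafOn A (z₀ ∷ z₁ ∷ map f l)
        ≈⟨ sumPicks-∷ z₁ (map f l) (λ w r → A z₀ w * hafOn A r) ⟩
      A z₀ z₁ * hafOn A (map f l) + sumPicks (map f l) (λ w r → A z₀ w * hafOn A (z₁ ∷ r))
        ≈⟨ +-cong (*-congˡ (hafOn-map A f l)) (trans (sumPicks-map f l _) (sumPicks-cong l second-row)) ⟩
      A z₀ z₁ * hafOn A′ l + crossSum l ∎
      where
      second-row : ∀ w r → A z₀ (f w) * hafOn A (z₁ ∷ map f r) ≈ sumPicks r (λ x q → a w * b x * hafOn A′ q)
      second-row w r = begin
        a w * hafOn A (z₁ ∷ map f r)
          ≈⟨ *-congˡ (trans (hafOn-∷ A z₁ (map f r)) (trans (sumPicks-map f r _)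
                (sumPicks-cong r (λ x q → *-congˡ (hafOn-map A f q))))) ⟩
        a w * sumPicks r (λ x q → b x * hafOn A′ q)
          ≈⟨ trans (*-distribˡ-sumPicks r _ _) (sumPicks-cong r (λ x q → sym (*-assoc _ _ _))) ⟩
        sumPicks r (λ x q → a w * b x * hafOn A′ q) ∎

-- allVecs enumerates Fin s through a local list; this is that list.
finList : (s : ℕ) → List (Fin s)
finList s = List.map head (allVecs s 1)

private
  map-head-singletons : (xs : List (Fin s)) → List.map head (List.map (λ a → a ∷ []) xs ++ []) ≡ xs
  map-head-singletons []       = ≡.refl
  map-head-singletons (x ∷ xs) = ≡.cong (x ∷_) (map-head-singletons xs)

finList-suc : (s : ℕ) → finList (suc s) ≡ zero ∷ List.map suc (finList s)
finList-suc s = ≡.trans (map-head-singletons _)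
  (≡.cong (λ xs → zero ∷ List.map suc xs) (≡.sym (map-head-singletons _)))

allVecs-suc : (s k : ℕ) → allVecs s (suc k) ≡ concatMap (λ v → List.map (_∷ v) (finList s)) (allVecs s k)
allVecs-suc s k =
  ≡.cong (λ xs → concatMap (λ v → List.map (_∷ v) xs) (allVecs s k)) (≡.sym (map-head-singletons _))

module Enumeration {c ℓ} (S : CommutativeRing c ℓ) where

  open CommutativeRing S hiding (zero)
  open RingSums S
  open RecursiveHafnian S
  open import Relation.Binary.Reasoning.Setoid setoid

  pairProduct : (Fin s → Fin s → Carrier) → List (Fin s) → Carrier
  pairProduct N []          = 1#
  pairProduct N (a ∷ [])    = 1#
  pairProduct N (a ∷ b ∷ r) = N a b * pairProduct N r

  hafEnum : (Fin s → Fin s → Carrier) → Carrier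
  hafEnum {s} N = foldr _+_ 0# (List.map (λ σ → pairProduct N (toList σ)) (C s))

  sumList-finList-δ : (v : Fin s) (h : Fin s → Carrier) →
                      sumList (finList s) (λ a → keepIf ⌊ a ≟ v ⌋ (h a)) ≈ h v
  sumList-finList-δ {suc s} v h =
    trans (reflexive (≡.cong (λ xs → sumList xs (λ a → keepIf ⌊ a ≟ v ⌋ (h a))) (finList-suc s))) (δ v)
    where
    δ : (v : Fin (suc s)) → sumList (zero ∷ List.map suc (finList s)) (λ a → keepIf ⌊ a ≟ v ⌋ (h a)) ≈ h v
    δ zero    = trans (+-congˡ (trans (sumList-map suc (finList s) _) (sumList-0 (finList s)))) (+-identityʳ _)
    δ (suc v) = trans (+-identityˡ _) (trans (sumList-map suc (finList s) _)
                  (trans (sumList-cong (finList s) suc-δ) (sumList-finList-δ v (λ a → h (suc a)))))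
      where
      suc-δ : ∀ a → keepIf ⌊ suc a ≟ suc v ⌋ (h (suc a)) ≈ keepIf ⌊ a ≟ v ⌋ (h (suc a))
      suc-δ a with a ≟ v
      ... | yes _ = refl
      ... | no _  = refl

  sumList-finList-∈ᵇ : (l : Vec (Fin s) (suc n)) → Distinct l → (g : Fin s → Vec (Fin s) n → Carrier) →
                       sumList (finList s) (λ b → keepIf (b ∈ᵇ l) (g b (remove l b))) ≈ sumPicks l g
  sumList-finList-∈ᵇ {s} (w ∷ []) d g =
    trans (sumList-cong (finList s) single) (sumList-finList-δ w (λ b → g b []))
    where
    single : ∀ b → keepIf (b ∈ᵇ (w ∷ [])) (g b []) ≈ keepIf ⌊ b ≟ w ⌋ (g b [])
    single b with b ≟ w
    ... | yes _ = refl
    ... | no _  = refl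
  sumList-finList-∈ᵇ {s} l@(w ∷ w′ ∷ ws) d g = begin
    sumList (finList s) (λ b → keepIf (b ∈ᵇ l) (g b (remove l b)))
      ≈⟨ trans (sumList-cong (finList s) split) (sumList-+ (finList s) _ _) ⟩
    sumList (finList s) (λ b → keepIf ⌊ b ≟ w ⌋ (g b (w′ ∷ ws)))
      + sumList (finList s) (λ b → keepIf (b ∈ᵇ (w′ ∷ ws)) (g b (w ∷ remove (w′ ∷ ws) b)))
      ≈⟨ +-cong (sumList-finList-δ w (λ b → g b (w′ ∷ ws)))
                (sumList-finList-∈ᵇ (w′ ∷ ws) (distinct-tail w (w′ ∷ ws) d) (λ z zs → g z (w ∷ zs))) ⟩
    sumPicks l g ∎
    where
    split : ∀ b → keepIf (b ∈ᵇ l) (g b (remove l b))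
                  ≈ keepIf ⌊ b ≟ w ⌋ (g b (w′ ∷ ws)) + keepIf (b ∈ᵇ (w′ ∷ ws)) (g b (w ∷ remove (w′ ∷ ws) b))
    split b with b ≟ w
    ... | yes ≡.refl with b ∈ᵇ (w′ ∷ ws) | distinct-head b (w′ ∷ ws) d
    ...   | true  | b∉ = ⊥-elim (b∉ _)
    ...   | false | _  = sym (+-identityʳ _)
    split b | no _ = sym (+-identityˡ _)

  sumList-allVecs-suc : (k : ℕ) (F : Vec (Fin s) (suc k) → Carrier) →
                        sumList (allVecs s (suc k)) F
                        ≈ sumList (allVecs s k) (λ ρ → sumList (finList s) (λ a → F (a ∷ ρ)))
  sumList-allVecs-suc {s} k F =
    trans (reflexive (≡.cong (λ xs → sumList xs F) (allVecs-suc s k)))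
          (trans (sumList-concatMap _ (allVecs s k) F)
                 (sumList-cong (allVecs s k) (λ ρ → sumList-map (_∷ ρ) (finList s) F)))

  sumList-pairings : (N : Fin s → Fin s → Carrier) (vs : Vec (Fin s) n) → Distinct vs →
                     sumList (allVecs s n) (λ σ → keepIf (pairingᵇ vs σ) (pairProduct N (toList σ)))
                     ≈ hafOn N vs
  sumList-pairings {s} N []       _ = +-identityʳ _
  sumList-pairings {s} N (v ∷ []) _ =
    trans (sumList-cong (allVecs s 1) (λ { (a ∷ []) → refl })) (sumList-0 (allVecs s 1))
  sumList-pairings {s} {suc (suc k)} N (v ∷ l@(w ∷ ws)) d = begin
    sumList (allVecs s (suc (suc k))) F
      ≈⟨ trans (sumList-allVecs-suc (suc k) F)
               (sumList-allVecs-suc k (λ u → sumList (finList s) (λ a → F (a ∷ u)))) ⟩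
    sumList (allVecs s k) (λ ρ → sumList (finList s) (λ b → sumList (finList s) (λ a → F (a ∷ b ∷ ρ))))
      ≈⟨ sumList-cong (allVecs s k) (λ ρ → sumList-cong (finList s) (λ b → first-pick b ρ)) ⟩
    sumList (allVecs s k) (λ ρ → sumList (finList s) (λ b → G b ρ))
      ≈⟨ sumList-swap (allVecs s k) (finList s) (λ ρ b → G b ρ) ⟩
    sumList (finList s) (λ b → sumList (allVecs s k) (G b))
      ≈⟨ sumList-cong (finList s) second-pick ⟩
    sumList (finList s) (λ b → keepIf (b ∈ᵇ l) (N v b * hafOn N (remove l b)))
      ≈⟨ sumList-finList-∈ᵇ l (distinct-tail v l d) (λ b r → N v b * hafOn N r) ⟩
    hafOn N (v ∷ w ∷ ws) ∎
    where
    F : Vec (Fin s) (suc (suc k)) → Carrier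
    F σ = keepIf (pairingᵇ (v ∷ l) σ) (pairProduct N (toList σ))
    G : Fin s → Vec (Fin s) k → Carrier
    G b ρ = keepIf (b ∈ᵇ l ∧ pairingᵇ (remove l b) ρ) (N v b * pairProduct N (toList ρ))
    first-pick : ∀ b ρ → sumList (finList s) (λ a → F (a ∷ b ∷ ρ)) ≈ G b ρ
    first-pick b ρ =
      trans (sumList-cong (finList s) (λ a → reflexive (keepIf-∧ ⌊ a ≟ v ⌋ _ _)))
            (sumList-finList-δ v (λ a → keepIf (b ∈ᵇ l ∧ pairingᵇ (remove l b) ρ)
                                               (N a b * pairProduct N (toList ρ))))
    second-pick : ∀ b → sumList (allVecs s k) (G b) ≈ keepIf (b ∈ᵇ l) (N v b * hafOn N (remove l b))
    second-pick b with b ∈ᵇ l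
    ... | false = sumList-0 (allVecs s k)
    ... | true  = begin
      sumList (allVecs s k) (λ ρ → keepIf (pairingᵇ (remove l b) ρ) (N v b * pairProduct N (toList ρ)))
        ≈⟨ sumList-cong (allVecs s k) (λ ρ → keepIf-* (pairingᵇ (remove l b) ρ) _ _) ⟩
      sumList (allVecs s k) (λ ρ → N v b * keepIf (pairingᵇ (remove l b) ρ) (pairProduct N (toList ρ)))
        ≈⟨ sym (*-distribˡ-sumList (allVecs s k) _ _) ⟩
      N v b * sumList (allVecs s k) (λ ρ → keepIf (pairingᵇ (remove l b) ρ) (pairProduct N (toList ρ)))
        ≈⟨ *-congˡ (sumList-pairings {n = k} N (remove l b) (remove-distinct l b (distinct-tail v l d))) ⟩
      N v b * hafOn N (remove l b) ∎

  hafEnum≈hafOn : (N : Fin s → Fin s → Carrier) → hafEnum N ≈ hafOn N (allFin s)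
  hafEnum≈hafOn {s} N = begin
    hafEnum N
      ≈⟨ sumList-filterᵇ _ (allVecs s s) _ ⟩
    sumList (allVecs s s) (λ σ → keepIf (distinctᵇ (toList σ) ∧ canonᵇ (toList σ)) (pairProduct N (toList σ)))
      ≈⟨ sumList-cong (allVecs s s) (λ σ →
           reflexive (≡.cong (λ p → keepIf p (pairProduct N (toList σ))) (C-predicate≡pairing σ))) ⟩
    sumList (allVecs s s) (λ σ → keepIf (pairingᵇ (allFin s) σ) (pairProduct N (toList σ)))
      ≈⟨ sumList-pairings N (allFin s) (sorted⇒distinct (allFin s) (allFin-sorted s)) ⟩
    hafOn N (allFin s) ∎

  pairProduct-cong : {M N : Fin s → Fin s → Carrier} → (∀ a b → a ≢ b → M a b ≈ N a b) →
                     (σ : List (Fin s)) → T (canonᵇ σ) → pairProduct M σ ≈ pairProduct N σ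
  pairProduct-cong M≈N []              _ = refl
  pairProduct-cong M≈N (a ∷ [])        _ = refl
  pairProduct-cong M≈N (a ∷ b ∷ [])    p = *-congʳ (M≈N a b (<⇒≢ (<ᵇ⇒< _ _ p)))
  pairProduct-cong M≈N (a ∷ b ∷ c ∷ r) p =
    *-cong (M≈N a b (<⇒≢ (proj₁ abc))) (pairProduct-cong M≈N (c ∷ r) (proj₂ (proj₂ abc)))
    where
    abc : a < b × a < c × T (canonᵇ (c ∷ r))
    abc = canon-∷∷∷⁻ a b c r p

  hafEnum-cong : {M N : Fin s → Fin s → Carrier} → (∀ a b → a ≢ b → M a b ≈ N a b) → hafEnum M ≈ hafEnum N
  hafEnum-cong {s} M≈N = trans (sumList-filterᵇ _ (allVecs s s) _) (trans
    (sumList-cong (allVecs s s) (λ σ → keepIf-cong (distinctᵇ (toList σ) ∧ canonᵇ (toList σ))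
      (λ p → pairProduct-cong M≈N (toList σ) (proj₂ (Equivalence.to (Bool.T-∧ {distinctᵇ (toList σ)}) p)))))
    (sym (sumList-filterᵇ _ (allVecs s s) _)))

module SubsetRing {c ℓ} (R : CommutativeRing c ℓ) where

  open CommutativeRing R hiding (zero)
  open WithRing R
  open RingSums R using (sumList; sumList-cong; sumList-+; sumList-concatMap; keepIf-cong)
  open import Algebra.Properties.CommutativeSemigroup +-commutativeSemigroup using (interchange)

  private variable
    m : ℕ

  infix 4 _≈U_
  _≈U_ : RU m → RU m → Set ℓ
  r ≈U q = ∀ X → r X ≈ q X

  -- Splitting off the element 1 identifies R[U_{m+1}] with R[U_m][ε]/(ε²), ε = 1[{1}], via
  -- r ↦ head₀ r + ε head₁ r; the ring laws then follow by induction on m.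
  head₀ head₁ : RU (suc m) → RU m
  head₀ r Y = r (outside ∷ Y)
  head₁ r Y = r (inside ∷ Y)

  sumSubsets-suc : (f : Subset (suc m) → Carrier) →
                   sumList (allSubsets (suc m)) f
                   ≈ sumList (allSubsets m) (λ Y → f (outside ∷ Y) + f (inside ∷ Y))
  sumSubsets-suc {m} f =
    trans (sumList-concatMap _ (allSubsets m) f) (sumList-cong (allSubsets m) (λ Y → +-congˡ (+-identityʳ _)))

  *U-outside∷ : (r q : RU (suc m)) (X : Subset m) → (r *U q) (outside ∷ X) ≈ (head₀ r *U head₀ q) X
  *U-outside∷ {m} r q X = trans (sumSubsets-suc {m} _) (sumList-cong (allSubsets m) (λ Y → +-identityʳ _))

  *U-inside∷ : (r q : RU (suc m)) (X : Subset m) →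
               (r *U q) (inside ∷ X) ≈ ((head₀ r *U head₁ q) +U (head₁ r *U head₀ q)) X
  *U-inside∷ {m} r q X = trans (sumSubsets-suc {m} _) (sumList-+ (allSubsets m) _ _)

  *U-cong : {r r′ q q′ : RU m} → r ≈U r′ → q ≈U q′ → r *U q ≈U r′ *U q′
  *U-cong {m} r≈r′ q≈q′ X =
    sumList-cong (allSubsets m) (λ Y → keepIf-cong (Y ⊆ᵇ X) (λ _ → *-cong (r≈r′ Y) (q≈q′ (X ─ Y))))

  *U-congʳ : {r r′ : RU m} (q : RU m) → r ≈U r′ → r *U q ≈U r′ *U q
  *U-congʳ {r = r} {r′} q r≈r′ = *U-cong {r = r} {r′} {q} {q} r≈r′ (λ _ → refl)

  *U-congˡ : (r : RU m) {q q′ : RU m} → q ≈U q′ → r *U q ≈U r *U q′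
  *U-congˡ r {q} {q′} q≈q′ = *U-cong {r = r} {r} {q} {q′} (λ _ → refl) q≈q′

  record MultiplicativeLaws (m : ℕ) : Set (c ⊔ ℓ) where
    field
      *U-assoc      : (r q t : RU m) → (r *U q) *U t ≈U r *U (q *U t)
      *U-comm       : (r q : RU m) → r *U q ≈U q *U r
      *U-identityˡ  : (r : RU m) → 1U *U r ≈U r
      *U-zeroˡ      : (r : RU m) → 0U *U r ≈U 0U
      *U-distribˡ   : (r q t : RU m) → r *U (q +U t) ≈U (r *U q) +U (r *U t)

    *U-distribʳ : (r q t : RU m) → (q +U t) *U r ≈U (q *U r) +U (t *U r)
    *U-distribʳ r q t X = trans (*U-comm (q +U t) r X)
      (trans (*U-distribˡ r q t X) (+-cong (*U-comm r q X) (*U-comm r t X)))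

  multiplicativeLaws : (m : ℕ) → MultiplicativeLaws m
  multiplicativeLaws zero = record
    { *U-assoc     = λ { r q t [] → trans (+-identityʳ _) (trans (*-congʳ (+-identityʳ _)) (trans (*-assoc _ _ _)
                            (sym (trans (+-identityʳ _) (*-congˡ (+-identityʳ _)))))) }
    ; *U-comm      = λ { r q [] → +-congʳ (*-comm _ _) }
    ; *U-identityˡ = λ { r [] → trans (+-identityʳ _) (*-identityˡ _) }
    ; *U-zeroˡ     = λ { r [] → trans (+-identityʳ _) (zeroˡ _) }
    ; *U-distribˡ  = λ { r q t [] → trans (+-identityʳ _) (trans (distribˡ _ _ _)
                            (sym (+-cong (+-identityʳ _) (+-identityʳ _)))) }
    }
  multiplicativeLaws (suc m) = record
    { *U-assoc = assoc ; *U-comm = comm ; *U-identityˡ = identityˡ ; *U-zeroˡ = zeroˡU ; *U-distribˡ = distribˡU }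
    where
    open MultiplicativeLaws (multiplicativeLaws m)
    open import Relation.Binary.Reasoning.Setoid setoid

    comm : (r q : RU (suc m)) → r *U q ≈U q *U r
    comm r q (false ∷ X) =
      trans (*U-outside∷ r q X) (trans (*U-comm (head₀ r) (head₀ q) X) (sym (*U-outside∷ q r X)))
    comm r q (true ∷ X)  = trans (*U-inside∷ r q X)
      (trans (+-cong (*U-comm (head₀ r) (head₁ q) X) (*U-comm (head₁ r) (head₀ q) X))
             (trans (+-comm _ _) (sym (*U-inside∷ q r X))))

    identityˡ : (r : RU (suc m)) → 1U *U r ≈U r
    identityˡ r (false ∷ X) = trans (*U-outside∷ 1U r X) (*U-identityˡ (head₀ r) X)
    identityˡ r (true ∷ X)  = trans (*U-inside∷ 1U r X)
      (trans (+-cong (*U-identityˡ (head₁ r) X) (*U-zeroˡ (head₀ r) X)) (+-identityʳ _))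

    zeroˡU : (r : RU (suc m)) → 0U *U r ≈U 0U
    zeroˡU r (false ∷ X) = trans (*U-outside∷ 0U r X) (*U-zeroˡ (head₀ r) X)
    zeroˡU r (true ∷ X)  = trans (*U-inside∷ 0U r X)
      (trans (+-cong (*U-zeroˡ (head₁ r) X) (*U-zeroˡ (head₀ r) X)) (+-identityʳ _))

    distribˡU : (r q t : RU (suc m)) → r *U (q +U t) ≈U (r *U q) +U (r *U t)
    distribˡU r q t (false ∷ X) = trans (*U-outside∷ r (q +U t) X)
      (trans (*U-distribˡ (head₀ r) (head₀ q) (head₀ t) X) (sym (+-cong (*U-outside∷ r q X) (*U-outside∷ r t X))))
    distribˡU r q t (true ∷ X)  = trans (*U-inside∷ r (q +U t) X)
      (trans (+-cong (*U-distribˡ (head₀ r) (head₁ q) (head₁ t) X) (*U-distribˡ (head₁ r) (head₀ q) (head₀ t) X))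
      (trans (interchange _ _ _ _) (sym (+-cong (*U-inside∷ r q X) (*U-inside∷ r t X)))))

    assoc : (r q t : RU (suc m)) → (r *U q) *U t ≈U r *U (q *U t)
    assoc r q t (false ∷ X) = begin
      ((r *U q) *U t) (false ∷ X)     ≈⟨ *U-outside∷ (r *U q) t X ⟩
      (head₀ (r *U q) *U t₀) X        ≈⟨ *U-congʳ t₀ (*U-outside∷ r q) X ⟩
      ((r₀ *U q₀) *U t₀) X            ≈⟨ *U-assoc r₀ q₀ t₀ X ⟩
      (r₀ *U (q₀ *U t₀)) X            ≈⟨ *U-congˡ r₀ (λ Y → sym (*U-outside∷ q t Y)) X ⟩
      (r₀ *U head₀ (q *U t)) X        ≈⟨ sym (*U-outside∷ r (q *U t) X) ⟩
      (r *U (q *U t)) (false ∷ X)     ∎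
      where
      r₀ q₀ t₀ : RU m
      r₀ = head₀ r
      q₀ = head₀ q
      t₀ = head₀ t
    assoc r q t (true ∷ X) = begin
      ((r *U q) *U t) (true ∷ X)
        ≈⟨ *U-inside∷ (r *U q) t X ⟩
      (head₀ (r *U q) *U t₁) X + (head₁ (r *U q) *U t₀) X
        ≈⟨ +-cong (*U-congʳ t₁ (*U-outside∷ r q) X) (*U-congʳ t₀ (*U-inside∷ r q) X) ⟩
      ((r₀ *U q₀) *U t₁) X + (((r₀ *U q₁) +U (r₁ *U q₀)) *U t₀) X
        ≈⟨ +-congˡ (*U-distribʳ t₀ (r₀ *U q₁) (r₁ *U q₀) X) ⟩
      ((r₀ *U q₀) *U t₁) X + (((r₀ *U q₁) *U t₀) X + ((r₁ *U q₀) *U t₀) X)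
        ≈⟨ +-cong (*U-assoc r₀ q₀ t₁ X) (+-cong (*U-assoc r₀ q₁ t₀ X) (*U-assoc r₁ q₀ t₀ X)) ⟩
      (r₀ *U (q₀ *U t₁)) X + ((r₀ *U (q₁ *U t₀)) X + (r₁ *U (q₀ *U t₀)) X)
        ≈⟨ sym (+-assoc _ _ _) ⟩
      ((r₀ *U (q₀ *U t₁)) X + (r₀ *U (q₁ *U t₀)) X) + (r₁ *U (q₀ *U t₀)) X
        ≈⟨ +-congʳ (sym (*U-distribˡ r₀ (q₀ *U t₁) (q₁ *U t₀) X)) ⟩
      (r₀ *U ((q₀ *U t₁) +U (q₁ *U t₀))) X + (r₁ *U (q₀ *U t₀)) X
        ≈⟨ +-cong (*U-congˡ r₀ (λ Y → sym (*U-inside∷ q t Y)) X) (*U-congˡ r₁ (λ Y → sym (*U-outside∷ q t Y)) X) ⟩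
      (r₀ *U head₁ (q *U t)) X + (r₁ *U head₀ (q *U t)) X
        ≈⟨ sym (*U-inside∷ r (q *U t) X) ⟩
      (r *U (q *U t)) (true ∷ X) ∎
      where
      r₀ r₁ q₀ q₁ t₀ t₁ : RU m
      r₀ = head₀ r
      r₁ = head₁ r
      q₀ = head₀ q
      q₁ = head₁ q
      t₀ = head₀ t
      t₁ = head₁ t

  RU-commutativeRing : ℕ → CommutativeRing c ℓ
  RU-commutativeRing m = record
    { Carrier = RU m
    ; _≈_ = _≈U_
    ; _+_ = _+U_
    ; _*_ = _*U_
    ; -_ = λ r X → - r X
    ; 0# = 0U
    ; 1# = 1U
    ; isCommutativeRing = record
      { isRing = record
        { +-isAbelianGroup = Pointwise.isAbelianGroup (Subset m) +-isAbelianGroup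
        ; *-cong = *U-cong
        ; *-assoc = *U-assoc
        ; *-identity = *U-identityˡ , (λ r X → trans (*U-comm r 1U X) (*U-identityˡ r X))
        ; distrib = *U-distribˡ , *U-distribʳ
        }
      ; *-comm = *U-comm
      }
    }
    where open MultiplicativeLaws (multiplicativeLaws m)

  -- The same splitting at the last element, with ε = 1[{m+1}] = single m.
  last₀ last₁ : RU (suc m) → RU m
  last₀ r X = r (X ∷ʳ outside)
  last₁ r X = r (X ∷ʳ inside)

  last₀-*U : (r q : RU (suc m)) → last₀ (r *U q) ≈U last₀ r *U last₀ q
  last₀-*U {zero}  r q []          = *U-outside∷ r q []
  last₀-*U {suc m} r q (false ∷ X) =
    trans (*U-outside∷ r q (X ∷ʳ outside))
      (trans (last₀-*U (head₀ r) (head₀ q) X) (sym (*U-outside∷ (last₀ r) (last₀ q) X)))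
  last₀-*U {suc m} r q (true ∷ X)  =
    trans (*U-inside∷ r q (X ∷ʳ outside))
      (trans (+-cong (last₀-*U (head₀ r) (head₁ q) X) (last₀-*U (head₁ r) (head₀ q) X))
             (sym (*U-inside∷ (last₀ r) (last₀ q) X)))

  last₁-*U : (r q : RU (suc m)) → last₁ (r *U q) ≈U (last₀ r *U last₁ q) +U (last₁ r *U last₀ q)
  last₁-*U {zero}  r q []          = *U-inside∷ r q []
  last₁-*U {suc m} r q (false ∷ X) =
    trans (*U-outside∷ r q (X ∷ʳ inside)) (trans (last₁-*U (head₀ r) (head₀ q) X)
      (sym (+-cong (*U-outside∷ (last₀ r) (last₁ q) X) (*U-outside∷ (last₁ r) (last₀ q) X))))
  last₁-*U {suc m} r q (true ∷ X)  =
    trans (*U-inside∷ r q (X ∷ʳ inside))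
      (trans (+-cong (last₁-*U (head₀ r) (head₁ q) X) (last₁-*U (head₁ r) (head₀ q) X))
      (trans (interchange _ _ _ _)
             (sym (+-cong (*U-inside∷ (last₀ r) (last₁ q) X) (*U-inside∷ (last₁ r) (last₀ q) X)))))

  insertLast≡∷ʳinside : (X : Subset m) → insertLast X ≡ X ∷ʳ inside
  insertLast≡∷ʳinside []      = ≡.refl
  insertLast≡∷ʳinside (x ∷ X) = ≡.cong (x ∷_) (insertLast≡∷ʳinside X)

  isEmptyᵇ-∷ʳ : (X : Subset m) (x : Bool) → isEmptyᵇ (X ∷ʳ x) ≡ isEmptyᵇ X ∧ not x
  isEmptyᵇ-∷ʳ []      x = Bool.∧-identityʳ (not x)
  isEmptyᵇ-∷ʳ (y ∷ X) x = ≡.trans (≡.cong (not y ∧_) (isEmptyᵇ-∷ʳ X x)) (≡.sym (Bool.∧-assoc (not y) _ _))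

  last₀-1U : last₀ (1U {suc m}) ≈U 1U
  last₀-1U X rewrite isEmptyᵇ-∷ʳ X outside | Bool.∧-identityʳ (isEmptyᵇ X) = refl

  last₁-1U : last₁ (1U {suc m}) ≈U 0U
  last₁-1U X rewrite isEmptyᵇ-∷ʳ X inside | Bool.∧-zeroʳ (isEmptyᵇ X) = refl

  embed-∷ʳ : (r : RU m) (X : Subset m) (x : Bool) → embed r (X ∷ʳ x) ≡ (if x then 0# else r X)
  embed-∷ʳ {zero}  r []      x = ≡.refl
  embed-∷ʳ {suc m} r (y ∷ X) x = embed-∷ʳ (λ Y → r (y ∷ Y)) X x

  last₀-embed : (r : RU m) → last₀ (embed r) ≈U r
  last₀-embed r X = reflexive (embed-∷ʳ r X outside)

  last₁-embed : (r : RU m) → last₁ (embed r) ≈U 0U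
  last₁-embed r X = reflexive (embed-∷ʳ r X inside)

  ∷ʳ-─-last : (X : Subset m) (x : Bool) → (X ∷ʳ x) ─ ⁅ fromℕ m ⁆ ≡ X ∷ʳ outside
  ∷ʳ-─-last []      x = ≡.refl
  ∷ʳ-─-last (y ∷ X) x = ≡.cong (y ∷_) (∷ʳ-─-last X x)

  last₀-single : last₀ (single m) ≈U 0U
  last₀-single X rewrite ∷ʳ-─-last X outside | Bool.∧-inverseʳ (isEmptyᵇ (X ∷ʳ outside)) = refl

  last₁-single : last₁ (single m) ≈U 1U
  last₁-single X rewrite ∷ʳ-─-last X inside | isEmptyᵇ-∷ʳ X outside | isEmptyᵇ-∷ʳ X inside with isEmptyᵇ X
  ... | true  = refl
  ... | false = refl

module StepIdentity {c ℓ} (R : CommutativeRing c ℓ) where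

  open CommutativeRing R hiding (zero)
  open WithRing R
  open SubsetRing R

  size≡2* : (n m k : ℕ) → n ≡ m N.+ k → size n m ≡ 2 N.* k
  size≡2* n zero    k n≡m+k = ≡.cong (2 N.*_) n≡m+k
  size≡2* n (suc m) k n≡m+k = ≡.cong (λ x → pred (pred x))
    (≡.trans (size≡2* n m (suc k) (≡.trans n≡m+k (≡.sym (+-suc m k)))) (*-suc 2 k))

  module _ {m : ℕ} where

    private
      module R₀ = CommutativeRing (RU-commutativeRing m)
      module Σ₀ = RingSums (RU-commutativeRing m)
      module Σ₁ = RingSums (RU-commutativeRing (suc m))
      module H₀ = RecursiveHafnian (RU-commutativeRing m)
      module H₁ = RecursiveHafnian (RU-commutativeRing (suc m))
      module E₀ = Enumeration (RU-commutativeRing m)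
      open MultiplicativeLaws (multiplicativeLaws m)

    last₀-sumPicks : {I : Set ℓ₁} (l : Vec I n) (g : I → Vec I _ → RU (suc m)) →
                     last₀ (Σ₁.sumPicks l g) ≈U Σ₀.sumPicks l (λ w r → last₀ (g w r))
    last₀-sumPicks []           g X = refl
    last₀-sumPicks (x ∷ [])     g X = refl
    last₀-sumPicks (x ∷ y ∷ ys) g X = +-congˡ (last₀-sumPicks (y ∷ ys) (λ z zs → g z (x ∷ zs)) X)

    last₁-sumPicks : {I : Set ℓ₁} (l : Vec I n) (g : I → Vec I _ → RU (suc m)) →
                     last₁ (Σ₁.sumPicks l g) ≈U Σ₀.sumPicks l (λ w r → last₁ (g w r))
    last₁-sumPicks []           g X = refl
    last₁-sumPicks (x ∷ [])     g X = refl
    last₁-sumPicks (x ∷ y ∷ ys) g X = +-congˡ (last₁-sumPicks (y ∷ ys) (λ z zs → g z (x ∷ zs)) X)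

    last₀-+single* : (d e : RU (suc m)) → last₀ (d +U (single m *U e)) ≈U last₀ d
    last₀-+single* d e X = trans (+-congˡ (trans (last₀-*U (single m) e X)
      (trans (*U-congʳ (last₀ e) last₀-single X) (*U-zeroˡ (last₀ e) X)))) (+-identityʳ _)

    last₁-+single* : (d e : RU (suc m)) → last₁ (d +U (single m *U e)) ≈U last₁ d +U last₀ e
    last₁-+single* d e X = +-congˡ (trans (last₁-*U (single m) e X)
      (trans (+-cong (trans (*U-congʳ (last₁ e) last₀-single X) (*U-zeroˡ (last₁ e) X))
                     (trans (*U-congʳ (last₀ e) last₁-single X) (*U-identityˡ (last₀ e) X)))
             (+-identityˡ _)))

    -- A hafnian over R[U_m][ε], ε = 1[{m+1}], of a matrix A + ε (a bᵀ + b aᵀ).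
    module FirstOrder {I : Set ℓ₁} (M : I → I → RU (suc m)) (A : I → I → RU m) (a b : I → RU m)
                      (M₀ : ∀ x y → last₀ (M x y) ≈U A x y)
                      (M₁ : ∀ x y → last₁ (M x y) ≈U (a x *U b y) +U (a y *U b x)) where

      open H₀.Rank2Perturbation A a b

      last₀-hafOn : (l : Vec I n) → last₀ (H₁.hafOn M l) ≈U H₀.hafOn A l
      last₀-hafOn []           = last₀-1U
      last₀-hafOn (v ∷ [])     X = refl
      last₀-hafOn {n = suc (suc n)} (v ∷ w ∷ ws) =
        R₀.trans (last₀-sumPicks (w ∷ ws) _)
          (Σ₀.sumPicks-cong (w ∷ ws) (λ x r → R₀.trans (last₀-*U (M v x) (H₁.hafOn M r))
            (*U-cong (M₀ v x) (last₀-hafOn {n = n} r))))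

      last₁-hafOn : (l : Vec I n) → last₁ (H₁.hafOn M l) ≈U hafDeriv l
      last₁-hafOn []           = last₁-1U
      last₁-hafOn (v ∷ [])     X = refl
      last₁-hafOn {n = suc (suc n)} (v ∷ w ∷ ws) =
        R₀.trans (last₁-sumPicks (w ∷ ws) _)
          (Σ₀.sumPicks-cong (w ∷ ws) (λ x r → R₀.trans (last₁-*U (M v x) (H₁.hafOn M r))
            (R₀.trans (R₀.+-cong (*U-cong (M₀ v x) (last₁-hafOn {n = n} r)) (*U-cong (M₁ v x) (last₀-hafOn r)))
                      (R₀.+-comm _ _))))

    pairProduct≡prodPairs : (N : Mat (RU m) s) (σ : List (Fin s)) → E₀.pairProduct N σ ≡ prodPairs N σ
    pairProduct≡prodPairs N []          = ≡.refl
    pairProduct≡prodPairs N (a ∷ [])    = ≡.refl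
    pairProduct≡prodPairs N (a ∷ b ∷ σ) = ≡.cong (N a b *U_) (pairProduct≡prodPairs N σ)

    haf≡hafEnum : (N : Mat (RU m) s) → haf N ≡ E₀.hafEnum N
    haf≡hafEnum {s} N =
      ≡.cong (foldr _+U_ 0U) (map-cong (λ σ → ≡.sym (pairProduct≡prodPairs N (toList σ))) (C s))

    haf≈hafOn : (N : Mat (RU m) s) → haf N ≈U H₀.hafOn N (allFin s)
    haf≈hafOn N X = trans (reflexive (≡.cong-app (haf≡hafEnum N) X)) (E₀.hafEnum≈hafOn N X)

    haf-congOffDiagonal : {N N′ : Mat (RU m) s} → (∀ j k → j ≢ k → N j k ≡ N′ j k) → haf N ≈U haf N′
    haf-congOffDiagonal {N = N} {N′} N≡N′ X =
      trans (reflexive (≡.cong-app (haf≡hafEnum N) X))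
        (trans (E₀.hafEnum-cong (λ j k j≢k Y → reflexive (≡.cong-app (N≡N′ j k j≢k) Y)) X)
               (reflexive (≡.cong-app (≡.sym (haf≡hafEnum N′)) X)))

  module _ {m s : ℕ} (A : Mat (RU m) (suc (suc s))) where

    private
      module H₀ = RecursiveHafnian (RU-commutativeRing m)
      module H₁ = RecursiveHafnian (RU-commutativeRing (suc m))
      open MultiplicativeLaws (multiplicativeLaws m)

      A′ : Mat (RU m) s
      A′ j k = A (suc (suc j)) (suc (suc k))
      a b : Fin s → RU m
      a j = A zero (suc (suc j))
      b j = A (suc zero) (suc (suc j))

      M : Mat (RU (suc m)) s
      M j k = embed (A′ j k) +U (single m *U (embed (a j *U b k) +U embed (a k *U b j)))

      step≡M : ∀ j k → j ≢ k → step A j k ≡ M j k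
      step≡M j k j≢k with j ≟ k
      ... | yes j≡k = ⊥-elim (j≢k j≡k)
      ... | no _    = ≡.refl

      M₀ : ∀ j k → last₀ (M j k) ≈U A′ j k
      M₀ j k X = trans (last₀-+single* (embed (A′ j k)) (embed (a j *U b k) +U embed (a k *U b j)) X)
                       (last₀-embed (A′ j k) X)

      M₁ : ∀ j k → last₁ (M j k) ≈U (a j *U b k) +U (a k *U b j)
      M₁ j k X = trans (last₁-+single* (embed (A′ j k)) (embed (a j *U b k) +U embed (a k *U b j)) X)
        (trans (+-cong (last₁-embed (A′ j k) X) (+-cong (last₀-embed (a j *U b k) X) (last₀-embed (a k *U b j) X)))
               (+-identityˡ _))

      open FirstOrder M A′ a b M₀ M₁
      open H₀.Rank2Perturbation A′ a b

      h β′ : RU (suc m)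
      h = haf (step A)
      β′ = betaStep A

      haf-step≈hafOn : h ≈U H₁.hafOn M (allFin s)
      haf-step≈hafOn X = trans (haf-congOffDiagonal step≡M X) (haf≈hafOn M X)

      last₀-β : last₀ β′ ≈U 1U
      last₀-β X = trans (last₀-+single* 1U (embed (A zero (suc zero))) X) (last₀-1U X)

      last₁-β : last₁ β′ ≈U A zero (suc zero)
      last₁-β X = trans (last₁-+single* 1U (embed (A zero (suc zero))) X)
        (trans (+-cong (last₁-1U X) (last₀-embed (A zero (suc zero)) X)) (+-identityˡ _))

    haf≈β*haf-step : (X : Subset m) → haf A X ≈ (betaStep A *U haf (step A)) (insertLast X)
    haf≈β*haf-step X = sym (begin
      (β′ *U h) (insertLast X)             ≡⟨ ≡.cong (β′ *U h) (insertLast≡∷ʳinside X) ⟩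
      last₁ (β′ *U h) X                    ≈⟨ last₁-*U β′ h X ⟩
      ((last₀ β′ *U last₁ h) +U (last₁ β′ *U last₀ h)) X
        ≈⟨ +-cong (*U-cong last₀-β (λ Y → trans (haf-step≈hafOn (Y ∷ʳ inside)) (last₁-hafOn (allFin s) Y)) X)
                  (*U-cong last₁-β (λ Y → trans (haf-step≈hafOn (Y ∷ʳ outside)) (last₀-hafOn (allFin s) Y)) X) ⟩
      (1U *U hafDeriv (allFin s)) X + (A zero (suc zero) *U H₀.hafOn A′ (allFin s)) X
        ≈⟨ +-congʳ (trans (*U-identityˡ (hafDeriv (allFin s)) X) (sym (crossSum≈hafDeriv (allFin s) X))) ⟩
      crossSum (allFin s) X + (A zero (suc zero) *U H₀.hafOn A′ (allFin s)) X
        ≈⟨ +-comm _ _ ⟩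
      ((A zero (suc zero) *U H₀.hafOn A′ (allFin s)) +U crossSum (allFin s)) X
        ≈⟨ sym (H₀.hafOn-expand₂ A zero (suc zero) (λ j → suc (suc j)) (allFin s) X) ⟩
      H₀.hafOn A (zero ∷ suc zero ∷ map (λ j → suc (suc j)) (allFin s)) X
        ≡⟨ ≡.cong (λ l → H₀.hafOn A l X) (≡.sym allFin₂) ⟩
      H₀.hafOn A (allFin (suc (suc s))) X
        ≈⟨ sym (haf≈hafOn A X) ⟩
      haf A X ∎)
      where
      open import Relation.Binary.Reasoning.Setoid setoid
      allFin₂ : allFin (suc (suc s)) ≡ zero ∷ suc zero ∷ map (λ j → suc (suc j)) (allFin s)
      allFin₂ = ≡.trans (allFin-map (suc s)) (≡.trans (≡.cong (λ l → zero ∷ map suc l) (allFin-map s))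
                  (≡.cong (λ l → zero ∷ suc zero ∷ l) (≡.sym (map-∘ suc suc (allFin s)))))

lemma1 : ∀ {c ℓ} (R : CommutativeRing c ℓ) →
    let open CommutativeRing R
        open WithRing R
    in (n : ℕ) → 1 ≤ n →
       (B : Fin (2 N.* n) → Fin (2 N.* n) → Carrier) →
       (∀ j k → B j k ≈ B k j) →
       (∀ j → B j j ≈ 0#) →
       (m : ℕ) → suc m ≤ n →
       (X : Subset m) →
       haf (Bseq n B m) X ≈ (β n B m *U haf (Bseq n B (suc m))) (insertLast X)
lemma1 {c} {ℓ} R n _ B _ _ m m<n X with m≤n⇒∃[o]m+o≡n m<n
... | k , 1+m+k≡n = ≡.subst OneStep (≡.sym size≡) haf≈β*haf-step (Bseq n B m) X
  where
  open CommutativeRing R using (Carrier; _≈_)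
  open WithRing R
  open StepIdentity R
  OneStep : ℕ → Set (c ⊔ ℓ)
  OneStep s = (A : Mat (RU m) s) (X : Subset m) → haf A X ≈ (betaStep A *U haf (step A)) (insertLast X)
  size≡ : size n m ≡ suc (suc (2 N.* k))
  size≡ = ≡.trans (size≡2* n m (suc k) (≡.trans (≡.sym 1+m+k≡n) (≡.sym (+-suc m k)))) (*-suc 2 k)
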